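{- For any two integers $k$ and $\ell$ with $2\leq k\leq \ell$, there exists a connected graph $G$ with $\gamma_{\rm MB}'(G)=k$ and $\gamma_{\rm MBT}'(G)=\ell$.
   Context: All graphs are finite and simple. In both the Maker-Breaker domination (MBD) game and the Maker-Breaker total domination (MBTD) game on $G$, two players, Dominator and Staller, alternately select previously unselected vertices of $G$. In the MBD game Dominator wins if his selected vertices contain a dominating set of $G$ (a set $D$ such that every vertex outside $D$ has a neighbor in $D$); in the MBTD game he wins if they contain a total dominating set of $G$ (a set $D$ such that every vertex of $G$ has a neighbor in $D$); otherwise Staller wins. In the S-game Staller moves first. $\gamma_{\rm MB}'(G)$ (resp. $\gamma_{\rm MBT}'(G)$) is the minimum number of moves Dominator needs to win the MBD (resp. MBTD) S-game under optimal play (Dominator trying to win as fast as possible, Staller trying to prevent or delay his win), and is $\infty$ if Dominator has no winning strategy. -}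

module Defs where

open import Data.Nat using (ℕ; zero; suc; _<_)
open import Data.Bool using (Bool; T)
open import Data.Fin using (Fin)
open import Data.Fin.Subset using (Subset; _∈_; _∉_; ⁅_⁆; _∪_; ⊥)
open import Data.Product using (Σ; ∃; _×_; _,_)
open import Data.Sum using (_⊎_)
open import Relation.Nullary using (¬_)

record Graph : Set where
  field
    n      : ℕ
    edge   : Fin n → Fin n → Bool
    sym    : ∀ u v → T (edge u v) → T (edge v u)
    irrefl : ∀ v → ¬ T (edge v v)

open Graph public

Adj : (G : Graph) → Fin (n G) → Fin (n G) → Set
Adj G u v = T (edge G u v)

data Walk (G : Graph) : Fin (n G) → Fin (n G) → Set where
  here : ∀ {u} → Walk G u u
  step : ∀ {u v w} → Adj G u v → Walk G v w → Walk G u w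

Connected : Graph → Set
Connected G = ∀ u v → Walk G u v

Dominating : (G : Graph) → Subset (n G) → Set
Dominating G D = ∀ v → v ∈ D ⊎ Σ (Fin (n G)) (λ u → u ∈ D × Adj G u v)

TotalDominating : (G : Graph) → Subset (n G) → Set
TotalDominating G D = ∀ v → Σ (Fin (n G)) (λ u → u ∈ D × Adj G u v)

Free : {m : ℕ} → Fin m → Subset m → Subset m → Set
Free v D S = v ∉ D × v ∉ S

-- Maker-Breaker game on G with Dominator's winning condition Goal (monotone in D).
-- WinD G Goal k D S : Dominator (to move), having chosen D while Staller chose S,
--   can force a win using at most k further moves of his own.
-- WinS G Goal k D S : same, with Staller to move.
-- The game ends with a Dominator win as soon as his vertices satisfy Goal; it ends
-- with a Staller win if all vertices are chosen and Goal fails (no free vertex).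
mutual
  data WinD (G : Graph) (Goal : Subset (n G) → Set) :
            ℕ → Subset (n G) → Subset (n G) → Set where
    doneD : ∀ {k D S} → Goal D → WinD G Goal k D S
    move  : ∀ {k D S} (v : Fin (n G)) → Free v D S →
            WinS G Goal k (D ∪ ⁅ v ⁆) S → WinD G Goal (suc k) D S

  data WinS (G : Graph) (Goal : Subset (n G) → Set) :
            ℕ → Subset (n G) → Subset (n G) → Set where
    doneS : ∀ {k D S} → Goal D → WinS G Goal k D S
    reply : ∀ {k D S} → Σ (Fin (n G)) (λ v → Free v D S) →
            (∀ v → Free v D S → WinD G Goal k D (S ∪ ⁅ v ⁆)) →
            WinS G Goal k D S

-- Dominator wins the S-game (Staller starts, empty board) in at most k moves.
WinsSGameWithin : (G : Graph) → (Subset (n G) → Set) → ℕ → Set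
WinsSGameWithin G Goal k = WinS G Goal k ⊥ ⊥

SGameNumber : (G : Graph) → (Subset (n G) → Set) → ℕ → Set
SGameNumber G Goal k = WinsSGameWithin G Goal k × (∀ j → j < k → ¬ WinsSGameWithin G Goal j)

γMB'≡ : Graph → ℕ → Set
γMB'≡ G k = SGameNumber G (Dominating G) k

γMBT'≡ : Graph → ℕ → Set
γMBT'≡ G k = SGameNumber G (TotalDominating G) k

{-# OPTIONS --safe #-}
module Submission where

-- For k = 2 + p and l = m + p with m ≥ 2, take vertices x t, y t, w t, where t runs over m
-- "chain" indices followed by p "tail" indices: the x's and y's form a clique, w t is adjacent
-- to y t and x t, and for a chain index t also to every x s with s < t.
--
-- Dominator wins in l moves by pairing x t with y t.  Staller claims
-- x 0, x 1, … in order: each time Dominator must answer y t at once, for otherwise Staller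
-- claims y t and w t has no neighbour left for Dominator.  So Dominator needs l moves.
--
-- Dominator wins in k moves with the pairs {x 0, x 1}, {y 0, w 0} and {x t, y t}
-- for the tail indices.  Staller opens with x 0; afterwards a dominating set must meet the
-- closed neighbourhoods of w 0, of the last chain w and of the p tail w's, which are pairwise
-- disjoint once x 0 is removed, and each Dominator move meets at most one of these k classes.

open import Defs hiding (sym)
open import Data.Bool using (true; false; not)
open import Data.Empty using (⊥-elim)
open import Data.Fin using (Fin; zero; suc; _≟_; toℕ; splitAt; join; fromℕ; fromℕ<)
  renaming (_≤_ to _≤ᶠ_)
open import Data.Fin.Properties
  using (any?; all?; ¬∀⟶∃¬; +↔⊎; join-splitAt; splitAt-join; toℕ-injective; toℕ-↑ˡ; toℕ-fromℕ<)
  renaming (_≤?_ to _≤ᶠ?_)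
open import Data.Fin.Subset using (Subset; _∈_; _∉_; _⊆_; ⁅_⁆; _∪_; ⊥; ⊤; ∣_∣)
open import Data.Fin.Subset.Properties
  using ( _∈?_; ∉⊥; x∈⁅x⁆; x∈⁅y⁆⇒x≡y; x∈p∪q⁺; x∈p∪q⁻
        ; p⊆q⇒∣p∣≤∣q∣; p⊂q⇒∣p∣<∣q∣; ∣p∣≤n; ∣⊤∣≡n; ∣⊥∣≡0; ∣⁅x⁆∣≡1)
open import Data.Maybe using (Maybe; just; nothing)
import Data.Maybe.Properties as Maybe
open import Data.Nat using (ℕ; zero; suc; _+_; _≤_; _<_; z≤n; s≤s)
open import Data.Nat.Properties
  using ( module ≤-Reasoning; ≤-refl; ≤-reflexive; ≤-trans; ≤-antisym; <-≤-trans; ≤-pred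
        ; n≤1+n; n≤0⇒n≡0; n≮0; <⇒≱; +-comm; +-suc; +-monoʳ-≤; m≤m+n; m<n⇒m<1+n
        ; m<1+n⇒m<n∨m≡n; m≤n⇒m<n∨m≡n; m≤n⇒∃[o]m+o≡n)
open import Data.Product using (Σ; ∃; _×_; _,_; proj₁; proj₂)
import Data.Product as Product
open import Data.Sum using (_⊎_; inj₁; inj₂; [_,_]; swap)
import Data.Sum.Properties as Sum
open import Data.Sum.Function.Propositional using (_⊎-↔_)
open import Data.Vec using ([]; _∷_; lookup; tabulate)
open import Data.Vec.Properties using (lookup∘tabulate; []=⇒lookup; lookup⇒[]=)
open import Function using (_∘_; _↔_; Inverse; Injection; mk↔ₛ′)
open import Function.Properties.Inverse using (Inverse⇒Injection; ↔-refl; ↔-sym; ↔-trans)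
open import Relation.Nullary using (¬_; Dec; yes; no; does; contradiction)
open import Relation.Nullary.Decidable
  using (⌊_⌋; _×-dec_; _⊎-dec_; ¬?; map′; dec-true; dec-false; toWitness; fromWitness)
open import Relation.Binary.PropositionalEquality
  using (_≡_; _≢_; refl; sym; trans; cong; subst; subst₂; module ≡-Reasoning)

module _ {n : ℕ} {p : Subset n} {x y : Fin n} where

  x∈p⇒x∈p∪⁅y⁆ : x ∈ p → x ∈ p ∪ ⁅ y ⁆
  x∈p⇒x∈p∪⁅y⁆ x∈p = x∈p∪q⁺ (inj₁ x∈p)

  x∈p∪⁅y⁆⇒x∈p⊎x≡y : x ∈ p ∪ ⁅ y ⁆ → x ∈ p ⊎ x ≡ y
  x∈p∪⁅y⁆⇒x∈p⊎x≡y x∈ with x∈p∪q⁻ p ⁅ y ⁆ x∈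
  ... | inj₁ x∈p = inj₁ x∈p
  ... | inj₂ x∈y = inj₂ (x∈⁅y⁆⇒x≡y y x∈y)

  x∉p∪⁅y⁆ : x ∉ p → x ≢ y → x ∉ p ∪ ⁅ y ⁆
  x∉p∪⁅y⁆ x∉p x≢y x∈ with x∈p∪⁅y⁆⇒x∈p⊎x≡y x∈
  ... | inj₁ x∈p = x∉p x∈p
  ... | inj₂ x≡y = x≢y x≡y

x∈p∪⁅x⁆ : ∀ {n} {p : Subset n} {x : Fin n} → x ∈ p ∪ ⁅ x ⁆
x∈p∪⁅x⁆ {x = x} = x∈p∪q⁺ (inj₂ (x∈⁅x⁆ x))

∣p∪q∣≤∣p∣+∣q∣ : ∀ {n} (p q : Subset n) → ∣ p ∪ q ∣ ≤ ∣ p ∣ + ∣ q ∣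
∣p∪q∣≤∣p∣+∣q∣ []            []            = z≤n
∣p∪q∣≤∣p∣+∣q∣ (true  ∷ p) (true  ∷ q) = s≤s (≤-trans (∣p∪q∣≤∣p∣+∣q∣ p q) (+-monoʳ-≤ ∣ p ∣ (n≤1+n ∣ q ∣)))
∣p∪q∣≤∣p∣+∣q∣ (true  ∷ p) (false ∷ q) = s≤s (∣p∪q∣≤∣p∣+∣q∣ p q)
∣p∪q∣≤∣p∣+∣q∣ (false ∷ p) (true  ∷ q) =
  ≤-trans (s≤s (∣p∪q∣≤∣p∣+∣q∣ p q)) (≤-reflexive (sym (+-suc ∣ p ∣ ∣ q ∣)))
∣p∪q∣≤∣p∣+∣q∣ (false ∷ p) (false ∷ q) = ∣p∪q∣≤∣p∣+∣q∣ p q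

module UnmetClasses {n r : ℕ} (_∈ᶜ_ : Fin n → Fin r → Set) (_∈ᶜ?_ : ∀ v i → Dec (v ∈ᶜ i)) where

  Meets : Subset n → Fin r → Set
  Meets D i = ∃ λ v → v ∈ D × v ∈ᶜ i

  meets? : ∀ D i → Dec (Meets D i)
  meets? D i = any? λ v → (v ∈? D) ×-dec (v ∈ᶜ? i)

  unmet : Subset n → Subset r
  unmet D = tabulate λ i → not (does (meets? D i))

  module _ {D : Subset n} {i : Fin r} where

    ∈unmet⁺ : ¬ Meets D i → i ∈ unmet D
    ∈unmet⁺ ¬m =
      lookup⇒[]= i (unmet D) (trans (lookup∘tabulate _ i) (cong not (dec-false (meets? D i) ¬m)))

    ∈unmet⁻ : i ∈ unmet D → ¬ Meets D i
    ∈unmet⁻ i∈ m = false≢true (begin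
      false                      ≡⟨ cong not (dec-true (meets? D i) m) ⟨
      not (does (meets? D i))    ≡⟨ lookup∘tabulate _ i ⟨
      lookup (unmet D) i         ≡⟨ []=⇒lookup i∈ ⟩
      true                       ∎)
      where
      open ≡-Reasoning
      false≢true : false ≢ true
      false≢true ()

    Meets-∪⁅⁆ : ∀ {v} → Meets D i → Meets (D ∪ ⁅ v ⁆) i
    Meets-∪⁅⁆ (u , u∈D , u∈i) = u , x∈p⇒x∈p∪⁅y⁆ u∈D , u∈i

    Meets-∪⁅⁆⁻ : ∀ {v} → Meets (D ∪ ⁅ v ⁆) i → Meets D i ⊎ v ∈ᶜ i
    Meets-∪⁅⁆⁻ (u , u∈ , u∈i) with x∈p∪⁅y⁆⇒x∈p⊎x≡y u∈
    ... | inj₁ u∈D = inj₁ (u , u∈D , u∈i)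
    ... | inj₂ refl = inj₂ u∈i

  ∣unmet⊥∣≡r : ∣ unmet ⊥ ∣ ≡ r
  ∣unmet⊥∣≡r = ≤-antisym (∣p∣≤n (unmet ⊥))
    (subst (_≤ ∣ unmet ⊥ ∣) (∣⊤∣≡n r) (p⊆q⇒∣p∣≤∣q∣ {p = ⊤} λ _ → ∈unmet⁺ λ (_ , v∈⊥ , _) → ∉⊥ v∈⊥))

  ∣unmet∣≡0 : ∀ {D} → (∀ i → Meets D i) → ∣ unmet D ∣ ≡ 0
  ∣unmet∣≡0 {D} all = n≤0⇒n≡0 (subst (∣ unmet D ∣ ≤_) (∣⊥∣≡0 r)
    (p⊆q⇒∣p∣≤∣q∣ {q = ⊥} λ {i} i∈ → contradiction (all i) (∈unmet⁻ i∈)))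

  unmet-∪⁅⁆ : ∀ {D v} → unmet (D ∪ ⁅ v ⁆) ⊆ unmet D
  unmet-∪⁅⁆ i∈ = ∈unmet⁺ (∈unmet⁻ i∈ ∘ Meets-∪⁅⁆)

  ∣unmet-∪⁅⁆∣<∣unmet∣ : ∀ {D v i} → v ∈ᶜ i → ¬ Meets D i → ∣ unmet (D ∪ ⁅ v ⁆) ∣ < ∣ unmet D ∣
  ∣unmet-∪⁅⁆∣<∣unmet∣ {v = v} {i} v∈i ¬m =
    p⊂q⇒∣p∣<∣q∣ (unmet-∪⁅⁆ , i , ∈unmet⁺ ¬m , λ i∈ → ∈unmet⁻ i∈ (v , x∈p∪⁅x⁆ , v∈i))

  ∣unmet∣≤1+∣unmet-∪⁅⁆∣ : ∀ {D v} → (∀ {i j} → v ∈ᶜ i → v ∈ᶜ j → i ≡ j) →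
                          ∣ unmet D ∣ ≤ suc ∣ unmet (D ∪ ⁅ v ⁆) ∣
  ∣unmet∣≤1+∣unmet-∪⁅⁆∣ {D} {v} unique with any? (v ∈ᶜ?_)
  ... | no v∉any = ≤-trans (p⊆q⇒∣p∣≤∣q∣ still-unmet) (n≤1+n _)
    where
    still-unmet : unmet D ⊆ unmet (D ∪ ⁅ v ⁆)
    still-unmet {i} i∈ = ∈unmet⁺ λ m → [ ∈unmet⁻ i∈ , (λ v∈i → v∉any (i , v∈i)) ] (Meets-∪⁅⁆⁻ m)
  ... | yes (c , v∈c) = begin
      ∣ unmet D ∣                            ≤⟨ p⊆q⇒∣p∣≤∣q∣ unmet-but-c ⟩
      ∣ unmet (D ∪ ⁅ v ⁆) ∪ ⁅ c ⁆ ∣          ≤⟨ ∣p∪q∣≤∣p∣+∣q∣ (unmet (D ∪ ⁅ v ⁆)) ⁅ c ⁆ ⟩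
      ∣ unmet (D ∪ ⁅ v ⁆) ∣ + ∣ ⁅ c ⁆ ∣      ≡⟨ cong (∣ unmet (D ∪ ⁅ v ⁆) ∣ +_) (∣⁅x⁆∣≡1 c) ⟩
      ∣ unmet (D ∪ ⁅ v ⁆) ∣ + 1              ≡⟨ +-comm ∣ unmet (D ∪ ⁅ v ⁆) ∣ 1 ⟩
      suc ∣ unmet (D ∪ ⁅ v ⁆) ∣              ∎
    where
    open ≤-Reasoning
    unmet-but-c : unmet D ⊆ unmet (D ∪ ⁅ v ⁆) ∪ ⁅ c ⁆
    unmet-but-c {i} i∈ with i ≟ c
    ... | yes refl = x∈p∪⁅x⁆
    ... | no i≢c = x∈p⇒x∈p∪⁅y⁆ (∈unmet⁺ λ m →
                     [ ∈unmet⁻ i∈ , (λ v∈i → i≢c (unique v∈i v∈c)) ] (Meets-∪⁅⁆⁻ m))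

module PairingStrategy
  (G : Graph) (Goal : Subset (n G) → Set) {r : ℕ}
  (p q : Fin r → Fin (n G)) (p≢q : ∀ i → p i ≢ q i)
  (label : Fin (n G) → Maybe (Fin r))
  (label-p : ∀ i → label (p i) ≡ just i) (label-q : ∀ i → label (q i) ≡ just i)
  (complete : ∀ D → (∀ i → p i ∈ D ⊎ q i ∈ D) → Goal D)
  where

  InPair : Fin (n G) → Fin r → Set
  InPair v i = v ≡ p i ⊎ v ≡ q i

  open UnmetClasses InPair (λ v i → (v ≟ p i) ⊎-dec (v ≟ q i))

  pairs-disjoint : ∀ {v i j} → InPair v i → InPair v j → i ≡ j
  pairs-disjoint {v} v∈i v∈j = Maybe.just-injective (trans (sym (labelled v∈i)) (labelled v∈j))
    where
    labelled : ∀ {i} → InPair v i → label v ≡ just i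
    labelled {i} (inj₁ refl) = label-p i
    labelled {i} (inj₂ refl) = label-q i

  other : ∀ c v → ∃ λ u → InPair u c × u ≢ v
  other c v with v ≟ p c
  ... | yes refl = q c , inj₂ refl , p≢q c ∘ sym
  ... | no v≢p = p c , inj₁ refl , v≢p ∘ sym

  StallerInMetPairs : Subset (n G) → Subset (n G) → Set
  StallerInMetPairs D S = ∀ {v i} → v ∈ S → InPair v i → Meets D i

  Invariant : ℕ → Subset (n G) → Subset (n G) → Set
  Invariant j D S = ∣ unmet D ∣ ≤ j × StallerInMetPairs D S

  unmet-pair-free : ∀ {D S v i} → StallerInMetPairs D S → ¬ Meets D i → InPair v i → Free v D S
  unmet-pair-free safe ¬m v∈i = (λ v∈D → ¬m (_ , v∈D , v∈i)) , (λ v∈S → ¬m (safe v∈S v∈i))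

  -- Dominator answers a move into an unmet pair with its partner, any other move with a vertex
  -- of the unmet pair i.
  answer : ∀ {D v i} → ¬ Meets D i →
           ∃ λ u → ∃ λ c → InPair u c × ¬ Meets D c × u ≢ v ×
                          (∀ {c′} → InPair v c′ → Meets (D ∪ ⁅ u ⁆) c′)
  answer {D} {v} {i} ¬mᵢ with any? (λ c → ¬? (meets? D c) ×-dec ((v ≟ p c) ⊎-dec (v ≟ q c)))
  ... | yes (c , ¬m , v∈c) with other c v
  ...   | u , u∈c , u≢v = u , c , u∈c , ¬m , u≢v ,
                          λ v∈c′ → u , x∈p∪⁅x⁆ , subst (InPair u) (pairs-disjoint v∈c v∈c′) u∈c
  answer {D} {v} {i} ¬mᵢ | no none =
    p i , i , inj₁ refl , ¬mᵢ , (λ { refl → none (i , ¬mᵢ , inj₁ refl) }) , met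
    where
    met : ∀ {c′} → InPair v c′ → Meets (D ∪ ⁅ p i ⁆) c′
    met {c′} v∈c′ with meets? D c′
    ... | yes m = Meets-∪⁅⁆ m
    ... | no ¬m = ⊥-elim (none (c′ , ¬m , v∈c′))

  mutual
    stallerTurn : ∀ {j D S} → Invariant j D S → WinS G Goal j D S
    stallerTurn {D = D} inv with all? (meets? D)
    ... | yes all = doneS (complete D λ i → pairMet (all i))
      where
      pairMet : ∀ {i} → Meets D i → p i ∈ D ⊎ q i ∈ D
      pairMet (_ , v∈D , inj₁ refl) = inj₁ v∈D
      pairMet (_ , v∈D , inj₂ refl) = inj₂ v∈D
    ... | no ¬all with ¬∀⟶∃¬ r (Meets D) (meets? D) ¬all
    ...   | i , ¬mᵢ = reply (p i , unmet-pair-free (proj₂ inv) ¬mᵢ (inj₁ refl))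
                            (λ v free → dominatorTurn inv free ¬mᵢ)

    dominatorTurn : ∀ {j D S v i} → Invariant j D S → Free v D S → ¬ Meets D i →
                    WinD G Goal j D (S ∪ ⁅ v ⁆)
    dominatorTurn {zero} (bound , _) _ ¬mᵢ =
      ⊥-elim (n≮0 (<-≤-trans (∣unmet-∪⁅⁆∣<∣unmet∣ (inj₁ refl) ¬mᵢ) bound))
    dominatorTurn {suc j} {D} {S} {v} (bound , safe) _ ¬mᵢ with answer ¬mᵢ
    ... | u , c , u∈c , ¬m , u≢v , covers with unmet-pair-free safe ¬m u∈c
    ...   | u∉D , u∉S =
      move u (u∉D , x∉p∪⁅y⁆ u∉S u≢v)
        (stallerTurn (≤-pred (<-≤-trans (∣unmet-∪⁅⁆∣<∣unmet∣ u∈c ¬m) bound) , safe′))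
      where
      safe′ : StallerInMetPairs (D ∪ ⁅ u ⁆) (S ∪ ⁅ v ⁆)
      safe′ w∈ w∈i with x∈p∪⁅y⁆⇒x∈p⊎x≡y w∈
      ... | inj₁ w∈S = Meets-∪⁅⁆ (safe w∈S w∈i)
      ... | inj₂ refl = covers w∈i

  pairing-wins : WinsSGameWithin G Goal r
  pairing-wins = stallerTurn (≤-reflexive ∣unmet⊥∣≡r , λ v∈⊥ _ → ⊥-elim (∉⊥ v∈⊥))

module ClassLowerBound
  (G : Graph) (Goal : Subset (n G) → Set) {r : ℕ}
  (label : Fin (n G) → Maybe (Fin r)) (x₀ : Fin (n G))
  (needs : ∀ D → x₀ ∉ D → Goal D → ∀ i → ∃ λ v → v ∈ D × label v ≡ just i)
  where

  open UnmetClasses (λ v i → label v ≡ just i) (λ v i → Maybe.≡-dec _≟_ (label v) (just i))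

  labels-unique : ∀ {v i j} → label v ≡ just i → label v ≡ just j → i ≡ j
  labels-unique eᵢ eⱼ = Maybe.just-injective (trans (sym eᵢ) eⱼ)

  goal⇒∣unmet∣≤ : ∀ {j D} → x₀ ∉ D → Goal D → ∣ unmet D ∣ ≤ j
  goal⇒∣unmet∣≤ x₀∉D goal = ≤-trans (≤-reflexive (∣unmet∣≡0 (needs _ x₀∉D goal))) z≤n

  mutual
    winD⇒∣unmet∣≤ : ∀ {j D S} → WinD G Goal j D S → x₀ ∈ S → x₀ ∉ D → ∣ unmet D ∣ ≤ j
    winD⇒∣unmet∣≤ (doneD goal) _ x₀∉D = goal⇒∣unmet∣≤ x₀∉D goal
    winD⇒∣unmet∣≤ (move v (_ , v∉S) next) x₀∈S x₀∉D =
      ≤-trans (∣unmet∣≤1+∣unmet-∪⁅⁆∣ labels-unique)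
              (s≤s (winS⇒∣unmet∣≤ next x₀∈S (x∉p∪⁅y⁆ x₀∉D λ { refl → v∉S x₀∈S })))

    winS⇒∣unmet∣≤ : ∀ {j D S} → WinS G Goal j D S → x₀ ∈ S → x₀ ∉ D → ∣ unmet D ∣ ≤ j
    winS⇒∣unmet∣≤ (doneS goal) _ x₀∉D = goal⇒∣unmet∣≤ x₀∉D goal
    winS⇒∣unmet∣≤ (reply (v , free) next) x₀∈S x₀∉D = winD⇒∣unmet∣≤ (next v free) (x∈p⇒x∈p∪⁅y⁆ x₀∈S) x₀∉D

  winsSGameWithin⇒r≤ : ∀ {j} → WinsSGameWithin G Goal j → r ≤ j
  winsSGameWithin⇒r≤ {j} game = subst (_≤ j) ∣unmet⊥∣≡r (opening game)
    where
    opening : WinsSGameWithin G Goal j → ∣ unmet ⊥ ∣ ≤ j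
    opening (doneS goal) = goal⇒∣unmet∣≤ ∉⊥ goal
    opening (reply _ next) = winD⇒∣unmet∣≤ (next x₀ (∉⊥ , ∉⊥)) x∈p∪⁅x⁆ ∉⊥

Isolated : (G : Graph) → Subset (n G) → Subset (n G) → Fin (n G) → Set
Isolated G D S u = ∀ {v} → Adj G v u → v ∈ S × v ∉ D

module _ {G : Graph} where

  isolated⇒¬totalDominating : ∀ {D S u} → Isolated G D S u → ¬ TotalDominating G D
  isolated⇒¬totalDominating isolated td with td _
  ... | v , v∈D , v~u = proj₂ (isolated v~u) v∈D

  mutual
    isolated⇒¬winD : ∀ {j D S u} → Isolated G D S u → ¬ WinD G (TotalDominating G) j D S
    isolated⇒¬winD isolated (doneD td) = isolated⇒¬totalDominating isolated td
    isolated⇒¬winD {D = D} {S} {u} isolated (move v (_ , v∉S) next) = isolated⇒¬winS still-isolated next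
      where
      still-isolated : Isolated G (D ∪ ⁅ v ⁆) S u
      still-isolated w~u with isolated w~u
      ... | w∈S , w∉D = w∈S , x∉p∪⁅y⁆ w∉D λ { refl → v∉S w∈S }

    isolated⇒¬winS : ∀ {j D S u} → Isolated G D S u → ¬ WinS G (TotalDominating G) j D S
    isolated⇒¬winS isolated (doneS td) = isolated⇒¬totalDominating isolated td
    isolated⇒¬winS isolated (reply (v , free) next) =
      isolated⇒¬winD (λ w~u → x∈p⇒x∈p∪⁅y⁆ (proj₁ (isolated w~u)) , proj₂ (isolated w~u)) (next v free)

  threat⇒¬winS : ∀ {j D S u z} → Free z D S → Isolated G D (S ∪ ⁅ z ⁆) u →
                 ¬ WinS G (TotalDominating G) j D S
  threat⇒¬winS _ isolated (doneS td) = isolated⇒¬totalDominating isolated td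
  threat⇒¬winS free isolated (reply _ next) = isolated⇒¬winD isolated (next _ free)

_++ʷ_ : ∀ {G u v w} → Walk G u v → Walk G v w → Walk G u w
here          ++ʷ walk = walk
step u~v rest ++ʷ walk = step u~v (rest ++ʷ walk)

module SymmetricClosure {V : Set} {N : ℕ} (code : V ↔ Fin N)
  (E : V → V → Set) (E? : ∀ u v → Dec (E u v)) (E-irrefl : ∀ {v} → ¬ E v v)
  where

  open Inverse code public using (from; strictlyInverseˡ; strictlyInverseʳ) renaming (to to ⌜_⌝)

  Adjacent : V → V → Set
  Adjacent u v = E u v ⊎ E v u

  adjacent? : ∀ u v → Dec (Adjacent u v)
  adjacent? u v = E? u v ⊎-dec E? v u

  graph : Graph
  graph = record
    { n      = N
    ; edge   = λ a b → ⌊ adjacent? (from a) (from b) ⌋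
    ; sym    = λ _ _ a~b → fromWitness (swap (toWitness a~b))
    ; irrefl = λ _ a~a → [ E-irrefl , E-irrefl ] (toWitness a~a)
    }

  ⌜⌝-injective : ∀ {u v} → ⌜ u ⌝ ≡ ⌜ v ⌝ → u ≡ v
  ⌜⌝-injective = Injection.injective (Inverse⇒Injection code)

  every-vertex : ∀ {P : Fin N → Set} → (∀ v → P ⌜ v ⌝) → ∀ a → P a
  every-vertex {P = P} P⌜⌝ a = subst P (strictlyInverseˡ a) (P⌜⌝ (from a))

  adj⁺ : ∀ {u v} → Adjacent u v → Adj graph ⌜ u ⌝ ⌜ v ⌝
  adj⁺ {u} {v} u~v =
    fromWitness (subst₂ Adjacent (sym (strictlyInverseʳ u)) (sym (strictlyInverseʳ v)) u~v)

  adj⁻ : ∀ {a v} → Adj graph a ⌜ v ⌝ → ∃ λ u → a ≡ ⌜ u ⌝ × Adjacent u v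
  adj⁻ {a} {v} a~v =
    from a , sym (strictlyInverseˡ a) , subst (Adjacent (from a)) (strictlyInverseʳ v) (toWitness a~v)

module HalfGraph (e p : ℕ) where

  m : ℕ
  m = 2 + e

  L : ℕ
  L = m + p

  Index : Set
  Index = Fin m ⊎ Fin p

  _≟ᵢ_ : (s t : Index) → Dec (s ≡ t)
  _≟ᵢ_ = Sum.≡-dec _≟_ _≟_

  c₀ c₁ : Index
  c₀ = inj₁ zero
  c₁ = inj₁ (suc zero)

  data Vertex : Set where
    x y w : Index → Vertex

  data _⊴_ : Index → Index → Set where
    chain : ∀ {s t} → s ≤ᶠ t → inj₁ s ⊴ inj₁ t
    tail  : ∀ {j} → inj₂ j ⊴ inj₂ j

  ⊴-refl : ∀ {t} → t ⊴ t
  ⊴-refl {inj₁ s} = chain ≤-refl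
  ⊴-refl {inj₂ j} = tail

  _⊴?_ : ∀ s t → Dec (s ⊴ t)
  inj₁ s ⊴? inj₁ t  = map′ chain (λ { (chain s≤t) → s≤t }) (s ≤ᶠ? t)
  inj₁ _ ⊴? inj₂ _  = no λ ()
  inj₂ _ ⊴? inj₁ _  = no λ ()
  inj₂ j ⊴? inj₂ j′ = map′ (λ { refl → tail }) (λ { tail → refl }) (j ≟ j′)

  data Edge : Vertex → Vertex → Set where
    xx : ∀ {s t} → s ≢ t → Edge (x s) (x t)
    yy : ∀ {s t} → s ≢ t → Edge (y s) (y t)
    xy : ∀ {s t} → Edge (x s) (y t)
    yw : ∀ {t} → Edge (y t) (w t)
    xw : ∀ {s t} → s ⊴ t → Edge (x s) (w t)

  edge? : ∀ u v → Dec (Edge u v)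
  edge? (x s) (x t) = map′ xx (λ { (xx s≢t) → s≢t }) (¬? (s ≟ᵢ t))
  edge? (x s) (y t) = yes xy
  edge? (x s) (w t) = map′ xw (λ { (xw s⊴t) → s⊴t }) (s ⊴? t)
  edge? (y s) (x t) = no λ ()
  edge? (y s) (y t) = map′ yy (λ { (yy s≢t) → s≢t }) (¬? (s ≟ᵢ t))
  edge? (y s) (w t) = map′ (λ { refl → yw }) (λ { yw → refl }) (s ≟ᵢ t)
  edge? (w s) v     = no λ ()

  edge-irrefl : ∀ {v} → ¬ Edge v v
  edge-irrefl (xx s≢s) = s≢s refl
  edge-irrefl (yy s≢s) = s≢s refl

  -- Opaque, so that ⌜ v ⌝ stays neutral and ⁅ ⌜ v ⌝ ⁆ is not unfolded during unification.
  opaque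
    code : Vertex ↔ Fin (L + (L + L))
    code = ↔-trans (mk↔ₛ′ toSum fromSum toSum∘fromSum fromSum∘toSum)
           (↔-trans (index ⊎-↔ (index ⊎-↔ index)) (↔-trans (↔-refl ⊎-↔ ↔-sym +↔⊎) (↔-sym +↔⊎)))
      where
      index : Index ↔ Fin L
      index = ↔-sym +↔⊎
      toSum : Vertex → Index ⊎ (Index ⊎ Index)
      toSum (x t) = inj₁ t
      toSum (y t) = inj₂ (inj₁ t)
      toSum (w t) = inj₂ (inj₂ t)
      fromSum : Index ⊎ (Index ⊎ Index) → Vertex
      fromSum (inj₁ t)        = x t
      fromSum (inj₂ (inj₁ t)) = y t
      fromSum (inj₂ (inj₂ t)) = w t
      toSum∘fromSum : ∀ a → toSum (fromSum a) ≡ a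
      toSum∘fromSum (inj₁ t)        = refl
      toSum∘fromSum (inj₂ (inj₁ t)) = refl
      toSum∘fromSum (inj₂ (inj₂ t)) = refl
      fromSum∘toSum : ∀ v → fromSum (toSum v) ≡ v
      fromSum∘toSum (x t) = refl
      fromSum∘toSum (y t) = refl
      fromSum∘toSum (w t) = refl

  open SymmetricClosure code Edge edge? edge-irrefl public renaming (graph to G)

  to-x₀ : ∀ v → Walk G ⌜ v ⌝ ⌜ x c₀ ⌝
  to-x₀ (x s) = step (adj⁺ (inj₁ (xy {s} {c₀}))) (to-x₀ (y c₀))
  to-x₀ (y t) = step (adj⁺ (inj₂ (xy {c₀} {t}))) here
  to-x₀ (w t) = step (adj⁺ (inj₂ (yw {t}))) (to-x₀ (y t))

  from-x₀ : ∀ v → Walk G ⌜ x c₀ ⌝ ⌜ v ⌝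
  from-x₀ (x s) = from-x₀ (y c₀) ++ʷ step (adj⁺ (inj₂ (xy {s} {c₀}))) here
  from-x₀ (y t) = step (adj⁺ (inj₁ (xy {c₀} {t}))) here
  from-x₀ (w t) = from-x₀ (y t) ++ʷ step (adj⁺ (inj₁ (yw {t}))) here

  connected : Connected G
  connected = every-vertex λ u → every-vertex λ v → to-x₀ u ++ʷ from-x₀ v

  ⌜x⌝≢⌜y⌝ : ∀ {s t} → ⌜ x s ⌝ ≢ ⌜ y t ⌝
  ⌜x⌝≢⌜y⌝ {s} {t} x≡y with ⌜⌝-injective {x s} {y t} x≡y
  ... | ()

  XY : Index → Vertex → Set
  XY t v = v ≡ x t ⊎ v ≡ y t

  XY-clique : ∀ {s t u v} → s ≢ t → XY s u → XY t v → Adjacent u v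
  XY-clique s≢t (inj₁ refl) (inj₁ refl) = inj₁ (xx s≢t)
  XY-clique s≢t (inj₁ refl) (inj₂ refl) = inj₁ xy
  XY-clique s≢t (inj₂ refl) (inj₁ refl) = inj₂ xy
  XY-clique s≢t (inj₂ refl) (inj₂ refl) = inj₁ (yy s≢t)

  another : ∀ s → ∃ λ t → t ≢ s
  another s with s ≟ᵢ c₀
  ... | yes refl = c₁ , λ ()
  ... | no s≢c₀ = c₀ , s≢c₀ ∘ sym

  totallyDominating : ∀ D → (∀ t → ∃ λ v → XY t v × ⌜ v ⌝ ∈ D) → TotalDominating G D
  totallyDominating D met = every-vertex dominated
    where
    by-clique : ∀ {s v} → XY s v → ∃ λ a → a ∈ D × Adj G a ⌜ v ⌝
    by-clique {s} v∈s with another s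
    ... | t , t≢s with met t
    ...   | u , u∈t , u∈D = ⌜ u ⌝ , u∈D , adj⁺ (XY-clique t≢s u∈t v∈s)
    dominated : ∀ v → ∃ λ a → a ∈ D × Adj G a ⌜ v ⌝
    dominated (x s) = by-clique {s} (inj₁ refl)
    dominated (y s) = by-clique {s} (inj₂ refl)
    dominated (w t) with met t
    ... | _ , inj₁ refl , x∈D = ⌜ x t ⌝ , x∈D , adj⁺ (inj₁ (xw {t} {t} ⊴-refl))
    ... | _ , inj₂ refl , y∈D = ⌜ y t ⌝ , y∈D , adj⁺ (inj₁ (yw {t}))

  position : Index → Fin L
  position = join m p

  labelᵀ : Vertex → Maybe (Fin L)
  labelᵀ (x t) = just (position t)
  labelᵀ (y t) = just (position t)
  labelᵀ (w _) = nothing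

  labelᵀ-at : ∀ {i} v → labelᵀ v ≡ just (position (splitAt m i)) → labelᵀ (from ⌜ v ⌝) ≡ just i
  labelᵀ-at {i} v labelled =
    trans (cong labelᵀ (strictlyInverseʳ v)) (trans labelled (cong just (join-splitAt m p i)))

  pair-met : ∀ {D} → (∀ i → ⌜ x (splitAt m i) ⌝ ∈ D ⊎ ⌜ y (splitAt m i) ⌝ ∈ D) →
             ∀ t → ∃ λ v → XY t v × ⌜ v ⌝ ∈ D
  pair-met {D} met t with subst (λ s → ⌜ x s ⌝ ∈ D ⊎ ⌜ y s ⌝ ∈ D) (splitAt-join m p t) (met (position t))
  ... | inj₁ x∈D = x t , inj₁ refl , x∈D
  ... | inj₂ y∈D = y t , inj₂ refl , y∈D

  totalDomination-upper : WinsSGameWithin G (TotalDominating G) L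
  totalDomination-upper = PairingStrategy.pairing-wins G (TotalDominating G)
    (λ i → ⌜ x (splitAt m i) ⌝) (λ i → ⌜ y (splitAt m i) ⌝) (λ i → ⌜x⌝≢⌜y⌝ {splitAt m i} {splitAt m i})
    (labelᵀ ∘ from) (λ i → labelᵀ-at (x (splitAt m i)) refl) (λ i → labelᵀ-at (y (splitAt m i)) refl)
    (λ D met → totallyDominating D (pair-met met))

  w-neighbour : ∀ {a t} → Adj G a ⌜ w t ⌝ → a ≡ ⌜ y t ⌝ ⊎ ∃ λ s → a ≡ ⌜ x s ⌝ × s ⊴ t
  w-neighbour {a} {t} a~w with adj⁻ {a} {w t} a~w
  ... | _ , refl , inj₁ yw         = inj₁ refl
  ... | _ , refl , inj₁ (xw s⊴t)   = inj₂ (_ , refl , s⊴t)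

  rank : Index → ℕ
  rank t = toℕ (position t)

  rank-injective : ∀ {s t} → rank s ≡ rank t → s ≡ t
  rank-injective {s} {t} ranks≡ = begin
    s                         ≡⟨ splitAt-join m p s ⟨
    splitAt m (position s)    ≡⟨ cong (splitAt m) (toℕ-injective ranks≡) ⟩
    splitAt m (position t)    ≡⟨ splitAt-join m p t ⟩
    t                         ∎
    where open ≡-Reasoning

  ⊴⇒≡⊎rank< : ∀ {s t} → s ⊴ t → s ≡ t ⊎ rank s < rank t
  ⊴⇒≡⊎rank< (chain {s} {t} s≤t) with m≤n⇒m<n∨m≡n s≤t
  ... | inj₁ s<t = inj₂ (subst₂ _<_ (sym (toℕ-↑ˡ s p)) (sym (toℕ-↑ˡ t p)) s<t)
  ... | inj₂ s≡t = inj₁ (cong inj₁ (toℕ-injective s≡t))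
  ⊴⇒≡⊎rank< tail = inj₁ refl

  index-of-rank : ∀ {i} → i < L → ∃ λ t → rank t ≡ i
  index-of-rank i<L =
    splitAt m (fromℕ< i<L) , trans (cong toℕ (join-splitAt m p (fromℕ< i<L))) (toℕ-fromℕ< i<L)

  record Forced (i : ℕ) (D S : Subset (n G)) : Set where
    field
      D-ys     : ∀ {a} → a ∈ D → ∃ λ s → a ≡ ⌜ y s ⌝ × rank s < i
      S-xs     : ∀ {a} → a ∈ S → ∃ λ s → a ≡ ⌜ x s ⌝ × rank s < i
      xs-taken : ∀ {s} → rank s < i → ⌜ x s ⌝ ∈ S

  module _ {i D S} (F : Forced i D S) where
    open Forced F

    x∉D : ∀ s → ⌜ x s ⌝ ∉ D
    x∉D s x∈D with D-ys x∈D
    ... | s′ , x≡y , _ = ⌜x⌝≢⌜y⌝ {s} {s′} x≡y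

    y∉S : ∀ s → ⌜ y s ⌝ ∉ S
    y∉S s y∈S with S-xs y∈S
    ... | s′ , y≡x , _ = ⌜x⌝≢⌜y⌝ {s′} {s} (sym y≡x)

    x-fresh : ∀ s → i ≤ rank s → ⌜ x s ⌝ ∉ S
    x-fresh s i≤s x∈S with S-xs x∈S
    ... | s′ , x≡x , s′<i with ⌜⌝-injective {x s} {x s′} x≡x
    ...   | refl = <⇒≱ s′<i i≤s

    y-fresh : ∀ s → i ≤ rank s → ⌜ y s ⌝ ∉ D
    y-fresh s i≤s y∈D with D-ys y∈D
    ... | s′ , y≡y , s′<i with ⌜⌝-injective {y s} {y s′} y≡y
    ...   | refl = <⇒≱ s′<i i≤s

    ¬totalDominating : ∀ t → i ≤ rank t → ¬ TotalDominating G D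
    ¬totalDominating t i≤t td with td ⌜ w t ⌝
    ... | a , a∈D , a~w with w-neighbour {a} {t} a~w
    ...   | inj₁ refl           = y-fresh t i≤t a∈D
    ...   | inj₂ (s , refl , _) = x∉D s a∈D

    forced-step : ∀ t → rank t ≡ i → Forced (suc i) (D ∪ ⁅ ⌜ y t ⌝ ⁆) (S ∪ ⁅ ⌜ x t ⌝ ⁆)
    forced-step t t≡i = record { D-ys = grow y D-ys ; S-xs = grow x S-xs ; xs-taken = taken }
      where
      grow : ∀ {P : Subset (n G)} (V : Index → Vertex) →
             (∀ {a} → a ∈ P → ∃ λ s → a ≡ ⌜ V s ⌝ × rank s < i) →
             ∀ {a} → a ∈ P ∪ ⁅ ⌜ V t ⌝ ⁆ → ∃ λ s → a ≡ ⌜ V s ⌝ × rank s < suc i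
      grow V old a∈ with x∈p∪⁅y⁆⇒x∈p⊎x≡y a∈
      ... | inj₁ a∈P  = Product.map₂ (Product.map₂ m<n⇒m<1+n) (old a∈P)
      ... | inj₂ refl = t , refl , s≤s (≤-reflexive t≡i)
      taken : ∀ {s} → rank s < suc i → ⌜ x s ⌝ ∈ S ∪ ⁅ ⌜ x t ⌝ ⁆
      taken {s} s<1+i with m<1+n⇒m<n∨m≡n s<1+i
      ... | inj₁ s<i = x∈p⇒x∈p∪⁅y⁆ (xs-taken s<i)
      ... | inj₂ s≡i with rank-injective {s} {t} (trans s≡i (sym t≡i))
      ...   | refl = x∈p∪⁅x⁆

    w-isolated : ∀ t {u} → rank t ≡ i → u ∉ S ∪ ⁅ ⌜ x t ⌝ ⁆ → u ≢ ⌜ y t ⌝ →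
                 Isolated G (D ∪ ⁅ u ⁆) ((S ∪ ⁅ ⌜ x t ⌝ ⁆) ∪ ⁅ ⌜ y t ⌝ ⁆) ⌜ w t ⌝
    w-isolated t {u} t≡i u∉S′ u≢y {a} a~w with w-neighbour {a} {t} a~w
    ... | inj₁ refl = x∈p∪⁅x⁆ , x∉p∪⁅y⁆ (y-fresh t (≤-reflexive (sym t≡i))) (u≢y ∘ sym)
    ... | inj₂ (s , refl , s⊴t) = x∈p⇒x∈p∪⁅y⁆ x∈S′ , x∉p∪⁅y⁆ (x∉D s) λ { refl → u∉S′ x∈S′ }
      where
      x∈S′ : ⌜ x s ⌝ ∈ S ∪ ⁅ ⌜ x t ⌝ ⁆
      x∈S′ with ⊴⇒≡⊎rank< s⊴t
      ... | inj₁ refl = x∈p∪⁅x⁆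
      ... | inj₂ s<t  = x∈p⇒x∈p∪⁅y⁆ (xs-taken (subst (rank s <_) t≡i s<t))

  forced⇒¬winS : ∀ {i j D S} → i + j < L → Forced i D S → ¬ WinS G (TotalDominating G) j D S
  forced⇒¬winS {i} {j} {D} {S} i+j<L F with index-of-rank (≤-trans (s≤s (m≤m+n i j)) i+j<L)
  ... | t , t≡i = staller
    where
    i≤t : i ≤ rank t
    i≤t = ≤-reflexive (sym t≡i)
    dominator : ¬ WinD G (TotalDominating G) j D (S ∪ ⁅ ⌜ x t ⌝ ⁆)
    dominator (doneD td) = ¬totalDominating F t i≤t td
    dominator (move {k = j′} u (_ , u∉S′) next) with u ≟ ⌜ y t ⌝
    ... | yes refl = forced⇒¬winS (subst (_< L) (+-suc i j′) i+j<L) (forced-step F t t≡i) next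
    ... | no u≢y   = threat⇒¬winS (x∉p∪⁅y⁆ (y-fresh F t i≤t) (u≢y ∘ sym) ,
                                   x∉p∪⁅y⁆ (y∉S F t) (⌜x⌝≢⌜y⌝ {t} {t} ∘ sym))
                                   (w-isolated F t t≡i u∉S′ u≢y) next
    staller : ¬ WinS G (TotalDominating G) j D S
    staller (doneS td)     = ¬totalDominating F t i≤t td
    staller (reply _ next) = dominator (next ⌜ x t ⌝ (x∉D F t , x-fresh F t i≤t))

  totalDomination-lower : ∀ j → j < L → ¬ WinsSGameWithin G (TotalDominating G) j
  totalDomination-lower j j<L = forced⇒¬winS j<L record
    { D-ys     = λ a∈⊥ → ⊥-elim (∉⊥ a∈⊥)
    ; S-xs     = λ a∈⊥ → ⊥-elim (∉⊥ a∈⊥)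
    ; xs-taken = λ ()
    }

  pᴰ qᴰ : Fin (2 + p) → Vertex
  pᴰ zero          = x c₀
  pᴰ (suc zero)    = y c₀
  pᴰ (suc (suc j)) = x (inj₂ j)
  qᴰ zero          = x c₁
  qᴰ (suc zero)    = w c₀
  qᴰ (suc (suc j)) = y (inj₂ j)

  labelᴰ : Vertex → Maybe (Fin (2 + p))
  labelᴰ (x (inj₁ zero))             = just zero
  labelᴰ (x (inj₁ (suc zero)))       = just zero
  labelᴰ (x (inj₁ (suc (suc _))))    = nothing
  labelᴰ (x (inj₂ j))                = just (suc (suc j))
  labelᴰ (y (inj₁ zero))             = just (suc zero)
  labelᴰ (y (inj₁ (suc _)))          = nothing
  labelᴰ (y (inj₂ j))                = just (suc (suc j))
  labelᴰ (w (inj₁ zero))             = just (suc zero)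
  labelᴰ (w (inj₁ (suc _)))          = nothing
  labelᴰ (w (inj₂ _))                = nothing

  labelᴰ-p : ∀ i → labelᴰ (pᴰ i) ≡ just i
  labelᴰ-p zero          = refl
  labelᴰ-p (suc zero)    = refl
  labelᴰ-p (suc (suc j)) = refl

  labelᴰ-q : ∀ i → labelᴰ (qᴰ i) ≡ just i
  labelᴰ-q zero          = refl
  labelᴰ-q (suc zero)    = refl
  labelᴰ-q (suc (suc j)) = refl

  pᴰ≢qᴰ : ∀ i → pᴰ i ≢ qᴰ i
  pᴰ≢qᴰ zero          ()
  pᴰ≢qᴰ (suc zero)    ()
  pᴰ≢qᴰ (suc (suc j)) ()

  dominating : ∀ D → (∀ i → ⌜ pᴰ i ⌝ ∈ D ⊎ ⌜ qᴰ i ⌝ ∈ D) → Dominating G D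
  dominating D met = every-vertex dominated
    where
    Dominated : Vertex → Set
    Dominated v = ⌜ v ⌝ ∈ D ⊎ ∃ λ a → a ∈ D × Adj G a ⌜ v ⌝
    by-x : ∀ {c s v} → ⌜ x c ⌝ ∈ D → XY s v → Dominated v
    by-x {c} {s} x∈D (inj₁ refl) with c ≟ᵢ s
    ... | yes refl = inj₁ x∈D
    ... | no c≢s   = inj₂ (⌜ x c ⌝ , x∈D , adj⁺ (inj₁ (xx c≢s)))
    by-x {c} {s} x∈D (inj₂ refl) = inj₂ (⌜ x c ⌝ , x∈D , adj⁺ (inj₁ (xy {c} {s})))
    by-pair₀ : ∀ {s v} → XY s v → Dominated v
    by-pair₀ v∈s = [ (λ x∈D → by-x x∈D v∈s) , (λ x∈D → by-x x∈D v∈s) ] (met zero)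
    dominated : ∀ v → Dominated v
    dominated (x s) = by-pair₀ {s} (inj₁ refl)
    dominated (y s) = by-pair₀ {s} (inj₂ refl)
    dominated (w (inj₁ zero)) with met (suc zero)
    ... | inj₁ y∈D = inj₂ (⌜ y c₀ ⌝ , y∈D , adj⁺ (inj₁ yw))
    ... | inj₂ w∈D = inj₁ w∈D
    dominated (w (inj₁ (suc s))) with met zero
    ... | inj₁ x∈D = inj₂ (⌜ x c₀ ⌝ , x∈D , adj⁺ (inj₁ (xw (chain z≤n))))
    ... | inj₂ x∈D = inj₂ (⌜ x c₁ ⌝ , x∈D , adj⁺ (inj₁ (xw (chain (s≤s z≤n)))))
    dominated (w (inj₂ j)) with met (suc (suc j))
    ... | inj₁ x∈D = inj₂ (⌜ x (inj₂ j) ⌝ , x∈D , adj⁺ (inj₁ (xw tail)))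
    ... | inj₂ y∈D = inj₂ (⌜ y (inj₂ j) ⌝ , y∈D , adj⁺ (inj₁ yw))

  domination-upper : WinsSGameWithin G (Dominating G) (2 + p)
  domination-upper = PairingStrategy.pairing-wins G (Dominating G)
    (⌜_⌝ ∘ pᴰ) (⌜_⌝ ∘ qᴰ) (λ i → pᴰ≢qᴰ i ∘ ⌜⌝-injective)
    (labelᴰ ∘ from)
    (λ i → trans (cong labelᴰ (strictlyInverseʳ (pᴰ i))) (labelᴰ-p i))
    (λ i → trans (cong labelᴰ (strictlyInverseʳ (qᴰ i))) (labelᴰ-q i))
    dominating

  block : Index → Fin (2 + p)
  block (inj₁ zero)    = zero
  block (inj₁ (suc _)) = suc zero
  block (inj₂ j)       = suc (suc j)

  owner : Vertex → Maybe (Fin (2 + p))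
  owner (x (inj₁ zero)) = nothing
  owner (x s)           = just (block s)
  owner (y s)           = just (block s)
  owner (w s)           = just (block s)

  centre : Fin (2 + p) → Index
  centre zero          = c₀
  centre (suc zero)    = inj₁ (fromℕ (suc e))
  centre (suc (suc j)) = inj₂ j

  block-centre : ∀ i → block (centre i) ≡ i
  block-centre zero          = refl
  block-centre (suc zero)    = refl
  block-centre (suc (suc j)) = refl

  owner-x : ∀ {s} i → s ⊴ centre i → s ≢ c₀ → owner (x s) ≡ just i
  owner-x zero          (chain {zero} _)     s≢c₀ = ⊥-elim (s≢c₀ refl)
  owner-x (suc zero)    (chain {zero} _)     s≢c₀ = ⊥-elim (s≢c₀ refl)
  owner-x (suc zero)    (chain {suc _} _)    _    = refl
  owner-x (suc (suc j)) tail                 _    = refl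

  owned : ∀ {D i} v → ⌜ v ⌝ ∈ D → owner v ≡ just i → ∃ λ a → a ∈ D × owner (from a) ≡ just i
  owned v v∈D owns = ⌜ v ⌝ , v∈D , trans (cong owner (strictlyInverseʳ v)) owns

  domination-needs : ∀ D → ⌜ x c₀ ⌝ ∉ D → Dominating G D →
                     ∀ i → ∃ λ a → a ∈ D × owner (from a) ≡ just i
  domination-needs D x₀∉D dom i with dom ⌜ w (centre i) ⌝
  ... | inj₁ w∈D = owned (w (centre i)) w∈D (cong just (block-centre i))
  ... | inj₂ (a , a∈D , a~w) with w-neighbour {a} {centre i} a~w
  ...   | inj₁ refl             = owned (y (centre i)) a∈D (cong just (block-centre i))
  ...   | inj₂ (s , refl , s⊴c) = owned (x s) a∈D (owner-x i s⊴c λ { refl → x₀∉D a∈D })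

  domination-lower : ∀ j → j < 2 + p → ¬ WinsSGameWithin G (Dominating G) j
  domination-lower j j<k game =
    <⇒≱ j<k (ClassLowerBound.winsSGameWithin⇒r≤ G (Dominating G) (owner ∘ from) ⌜ x c₀ ⌝
                                                 domination-needs game)

theorem3p2 : (k l : ℕ) → 2 ≤ k → k ≤ l →
    Σ Graph (λ G → Connected G × γMB'≡ G k × γMBT'≡ G l)
theorem3p2 (suc (suc p)) l (s≤s (s≤s z≤n)) k≤l with m≤n⇒∃[o]m+o≡n k≤l
... | e , refl =
  G , connected , (domination-upper , domination-lower) ,
  subst (γMBT'≡ G) (cong (2 +_) (+-comm e p)) (totalDomination-upper , totalDomination-lower)
  where open HalfGraph e p
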